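{- For $n\ge 5$, the number of positions of \textsc{Col} played on the cycle $C_n$ satisfies \[P_{\textsc{Col},C_n}(1,1)=P_{\textsc{Col},P_{n-1}}(1,1)+3P_{\textsc{Col},P_{n-3}}(1,1)+2P_{\textsc{Col},P_{n-4}}(1,1)+P_{\textsc{Col},C_{n-2}}(1,1).\]
   Context: A distance game given by a pair of sets $(S,D)$ of positive integers is played on a finite graph by two players, Left (colouring vertices blue) and Right (colouring vertices red). A position is any assignment to a subset of the vertices of the colours blue or red (other vertices empty) such that no two vertices of the same colour are at graph distance in $S$ and no two vertices of different colours are at graph distance in $D$; no assumption of alternating play is made. \textsc{Col} is the distance game with $S=\{1\}$, $D=\emptyset$ (no two adjacent vertices of the same colour). $P_{G,B}(1,1)$ denotes the total number of positions of game $G$ on board $B$. $P_m$ is the path and $C_m$ the cycle with $m$ vertices ($P_0$ has one position). -}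

module Defs where

open import Data.Nat using (ℕ; zero; suc; _+_; _*_; _∸_; _≡ᵇ_)
open import Data.Bool using (Bool; true; false; _∧_; _∨_; not)
open import Data.Fin using (Fin; toℕ)
open import Data.Vec using (Vec; []; _∷_; lookup)
open import Data.List using (List; []; _∷_; map; concatMap; allFin; length; filter)
open import Relation.Nullary.Decidable using (does)
open import Data.Bool.Properties using (T?)
open import Data.Bool using (T)

-- State of a vertex: empty, coloured blue (Left), coloured red (Right).
data Cell : Set where
  empty blue red : Cell

record Graph : Set where
  field
    size : ℕ
    adj  : Fin size → Fin size → Bool
open Graph public

path : ℕ → Graph
path m = record { size = m ; adj = λ i j → (suc (toℕ i) ≡ᵇ toℕ j) ∨ (suc (toℕ j) ≡ᵇ toℕ i) }

cycle : ℕ → Graph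
cycle m = record { size = m ; adj = λ i j →
  (suc (toℕ i) ≡ᵇ toℕ j) ∨ (suc (toℕ j) ≡ᵇ toℕ i)
  ∨ ((toℕ i ≡ᵇ 0) ∧ (suc (toℕ j) ≡ᵇ m))
  ∨ ((toℕ j ≡ᵇ 0) ∧ (suc (toℕ i) ≡ᵇ m)) }

sameColour : Cell → Cell → Bool
sameColour blue blue = true
sameColour red red = true
sameColour _ _ = false

assignments : (n : ℕ) → List (Vec Cell n)
assignments zero = [] ∷ []
assignments (suc n) = concatMap (λ v → (empty ∷ v) ∷ (blue ∷ v) ∷ (red ∷ v) ∷ []) (assignments n)

allB : {A : Set} → (A → Bool) → List A → Bool
allB p [] = true
allB p (x ∷ xs) = p x ∧ allB p xs

-- Col legality: no two adjacent vertices (graph distance 1) receive the same colour.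
-- (S = {1}, D = ∅.)
isColPosition : (G : Graph) → Vec Cell (size G) → Bool
isColPosition G c =
  allB (λ i → allB (λ j → not (adj G i j ∧ sameColour (lookup c i) (lookup c j))) (allFin (size G)))
      (allFin (size G))

-- P_{Col,G}(1,1): total number of positions of Col on G.
numColPositions : Graph → ℕ
numColPositions G = length (filter (λ c → T? (isColPosition G c)) (assignments (size G)))

{-# OPTIONS --safe #-}
-- Col positions on a path are the words over {empty, blue, red} whose neighbouring letters are
-- compatible (not the same colour); on a cycle the last letter must also be compatible with the
-- first.  So they are counted by walks along the compatibility matrix M: a path on m vertices has
-- as many positions as the column of M^m at empty has total weight (an empty cell can always be
-- appended), and a cycle on m vertices has trace (M^m) positions.  The powers of M depend on only
-- three parameters, and their recursion gives  P(path (j+3)) = 2 P(path (j+2)) + P(path (j+1))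
-- and  P(cycle (j+3)) = P(cycle (j+1)) + 4 P(path (j+1)); the theorem combines the two.
module Submission where

open import Defs
open import Data.Nat using (ℕ; zero; suc; _+_; _*_; _∸_; _≤_; s≤s; z≤n; _≡ᵇ_)
open import Data.Nat.Properties using (≡ᵇ⇒≡; ≡⇒≡ᵇ; suc-injective; +-identityʳ; +-commutativeSemigroup)
open import Algebra.Properties.CommutativeSemigroup +-commutativeSemigroup using (xy∙z≈xz∙y; xy∙z≈yz∙x)
open import Data.Nat.Tactic.RingSolver using (solve-∀)
open import Data.Bool using (Bool; true; false; _∧_; not; T; if_then_else_)
open import Data.Bool.Properties using (T?; T-∧; T-∨; ∧-assoc; ∧-identityʳ)
open import Data.Unit using (tt)
open import Data.Product using (_×_; _,_; proj₁; proj₂)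
open import Data.Sum using ([_,_]; inj₁; inj₂)
open import Data.Fin using (Fin; toℕ; fromℕ) renaming (zero to fzero; suc to fsuc)
open import Data.Fin.Properties using (toℕ-injective; toℕ-fromℕ)
open import Data.Vec using (Vec; []; _∷_; _∷ʳ_; lookup; head; last)
open import Data.List using (List; []; _∷_; _++_; length; map; concatMap; filterᵇ; allFin)
open import Data.Nat.ListAction using (sum)
open import Data.List.Properties using (length-++; filter-++; filter-≐)
open import Data.List.Relation.Unary.All as All using (All; []; _∷_)
open import Data.List.Membership.Propositional.Properties using (∈-allFin)
open import Function using (_∘_; _⇔_; mk⇔; Equivalence)
open import Function.Construct.Composition using (_⇔-∘_)
open Equivalence using (to; from)
open import Relation.Binary.PropositionalEquality using (_≡_; refl; sym; trans; cong; cong₂; subst; subst₂; module ≡-Reasoning)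
open ≡-Reasoning

countᵇ : {A : Set} → (A → Bool) → List A → ℕ
countᵇ p = length ∘ filterᵇ p

countᵇ-∷ : {A : Set} (p : A → Bool) (x : A) (xs : List A) →
           countᵇ p (x ∷ xs) ≡ (if p x then 1 else 0) + countᵇ p xs
countᵇ-∷ p x xs with p x
... | true  = refl
... | false = refl

countᵇ-++ : {A : Set} (p : A → Bool) (xs ys : List A) →
            countᵇ p (xs ++ ys) ≡ countᵇ p xs + countᵇ p ys
countᵇ-++ p xs ys = trans (cong length (filter-++ (T? ∘ p) xs ys)) (length-++ (filterᵇ p xs))

countᵇ-map : {A B : Set} (p : B → Bool) (f : A → B) (xs : List A) →
             countᵇ p (map f xs) ≡ sum (map (λ x → if p (f x) then 1 else 0) xs)
countᵇ-map p f []       = refl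
countᵇ-map p f (x ∷ xs) = trans (countᵇ-∷ p (f x) (map f xs)) (cong (_ +_) (countᵇ-map p f xs))

countᵇ-false : {A : Set} (xs : List A) → countᵇ (λ _ → false) xs ≡ 0
countᵇ-false []       = refl
countᵇ-false (x ∷ xs) = countᵇ-false xs

cells : List Cell
cells = empty ∷ blue ∷ red ∷ []

Σᶜ : (Cell → ℕ) → ℕ
Σᶜ g = g empty + g blue + g red

Σᶜ-cong : {g h : Cell → ℕ} → (∀ x → g x ≡ h x) → Σᶜ g ≡ Σᶜ h
Σᶜ-cong g≗h = cong₂ _+_ (cong₂ _+_ (g≗h empty) (g≗h blue)) (g≗h red)

Σᶜ-+ : (g h : Cell → ℕ) → Σᶜ (λ x → g x + h x) ≡ Σᶜ g + Σᶜ h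
Σᶜ-+ g h = interchange (g empty) (g blue) (g red) (h empty) (h blue) (h red)
  where
  interchange : ∀ a b c a′ b′ c′ → (a + a′) + (b + b′) + (c + c′) ≡ (a + b + c) + (a′ + b′ + c′)
  interchange = solve-∀

sum-map-cells : (g : Cell → ℕ) → sum (map g cells) ≡ Σᶜ g
sum-map-cells g = reassociate (g empty) (g blue) (g red)
  where
  reassociate : ∀ a b c → a + (b + (c + 0)) ≡ a + b + c
  reassociate = solve-∀

count : (n : ℕ) → (Vec Cell n → Bool) → ℕ
count n p = countᵇ p (assignments n)

count-cong : (n : ℕ) {p q : Vec Cell n → Bool} → (∀ w → T (p w) ⇔ T (q w)) → count n p ≡ count n q
count-cong n p⇔q =
  cong length (filter-≐ (T? ∘ _) (T? ∘ _) ((λ {w} → to (p⇔q w)) , (λ {w} → from (p⇔q w))) (assignments n))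

T-cong : ∀ {a b} → a ≡ b → T a ⇔ T b
T-cong refl = mk⇔ (λ t → t) (λ t → t)

count-suc : (n : ℕ) (p : Vec Cell (suc n) → Bool) → count (suc n) p ≡ Σᶜ (λ x → count n (λ w → p (x ∷ w)))
count-suc n p = go (assignments n)
  where
  extensions : Vec Cell n → List (Vec Cell (suc n))
  extensions v = map (_∷ v) cells

  go : (vs : List (Vec Cell n)) → countᵇ p (concatMap extensions vs) ≡ Σᶜ (λ x → countᵇ (λ w → p (x ∷ w)) vs)
  go []       = refl
  go (v ∷ vs) = begin
    countᵇ p (extensions v ++ concatMap extensions vs)
      ≡⟨ countᵇ-++ p (extensions v) _ ⟩
    countᵇ p (extensions v) + countᵇ p (concatMap extensions vs)
      ≡⟨ cong₂ _+_ (trans (countᵇ-map p (_∷ v) cells) (sum-map-cells selected)) (go vs) ⟩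
    Σᶜ selected + Σᶜ rest
      ≡⟨ sym (Σᶜ-+ selected rest) ⟩
    Σᶜ (λ x → selected x + rest x)
      ≡⟨ Σᶜ-cong (λ x → sym (countᵇ-∷ (λ w → p (x ∷ w)) v vs)) ⟩
    Σᶜ (λ x → countᵇ (λ w → p (x ∷ w)) (v ∷ vs)) ∎
    where
    selected rest : Cell → ℕ
    selected x = if p (x ∷ v) then 1 else 0
    rest x = countᵇ (λ w → p (x ∷ w)) vs

count-guard : (n : ℕ) (b : Bool) (p : Vec Cell n → Bool) →
              count n (λ w → b ∧ p w) ≡ (if b then count n p else 0)
count-guard n true  p = refl
count-guard n false p = countᵇ-false (assignments n)

compatible : Cell → Cell → Bool
compatible x y = not (sameColour x y)

compatible-sym : ∀ x y → compatible x y ≡ compatible y x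
compatible-sym empty empty = refl
compatible-sym empty blue  = refl
compatible-sym empty red   = refl
compatible-sym blue  empty = refl
compatible-sym blue  blue  = refl
compatible-sym blue  red   = refl
compatible-sym red   empty = refl
compatible-sym red   blue  = refl
compatible-sym red   red   = refl

T-compatible-sym : ∀ {x y} → T (compatible x y) → T (compatible y x)
T-compatible-sym {x} {y} = subst T (compatible-sym x y)

compatible-empty : ∀ x → compatible x empty ≡ true
compatible-empty empty = refl
compatible-empty blue  = refl
compatible-empty red   = refl

chain : {n : ℕ} → Vec Cell n → Bool
chain []          = true
chain (x ∷ [])    = true
chain (x ∷ y ∷ w) = compatible x y ∧ chain (y ∷ w)

chain-∷ʳ : {n : ℕ} (c : Vec Cell (suc n)) (z : Cell) → chain (c ∷ʳ z) ≡ chain c ∧ compatible (last c) z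
chain-∷ʳ (x ∷ [])    z = ∧-identityʳ (compatible x z)
chain-∷ʳ (x ∷ y ∷ w) z =
  trans (cong (compatible x y ∧_) (chain-∷ʳ (y ∷ w) z)) (sym (∧-assoc (compatible x y) (chain (y ∷ w)) _))

chain-∷ʳ-empty : {n : ℕ} (c : Vec Cell (suc n)) → chain (c ∷ʳ empty) ≡ chain c
chain-∷ʳ-empty c = begin
  chain (c ∷ʳ empty)                        ≡⟨ chain-∷ʳ c empty ⟩
  chain c ∧ compatible (last c) empty       ≡⟨ cong (chain c ∧_) (compatible-empty (last c)) ⟩
  chain c ∧ true                            ≡⟨ ∧-identityʳ (chain c) ⟩
  chain c                                   ∎

lookup-fromℕ : {n : ℕ} (c : Vec Cell (suc n)) → lookup c (fromℕ n) ≡ last c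
lookup-fromℕ (x ∷ [])    = refl
lookup-fromℕ (x ∷ y ∷ w) = lookup-fromℕ (y ∷ w)

T-allB : {A : Set} (p : A → Bool) (xs : List A) → T (allB p xs) ⇔ All (T ∘ p) xs
T-allB p []       = mk⇔ (λ _ → []) (λ _ → tt)
T-allB p (x ∷ xs) = mk⇔
  (λ t → let px , pxs = to T-∧ t in px ∷ to (T-allB p xs) pxs)
  (λ { (px ∷ pxs) → from T-∧ (px , from (T-allB p xs) pxs) })

T-allB-allFin : {n : ℕ} (p : Fin n → Bool) → T (allB p (allFin n)) ⇔ (∀ i → T (p i))
T-allB-allFin {n} p = mk⇔
  (λ t i → All.lookup (to (T-allB p (allFin n)) t) (∈-allFin i))
  (λ all → from (T-allB p (allFin n)) (All.universal all (allFin n)))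

T-not-∧ : ∀ a b → T (not (a ∧ b)) ⇔ (T a → T (not b))
T-not-∧ true  b = mk⇔ (λ t _ → t) (λ f → f tt)
T-not-∧ false b = mk⇔ (λ _ ()) (λ _ → tt)

Proper : (G : Graph) → Vec Cell (size G) → Set
Proper G c = ∀ i j → T (adj G i j) → T (compatible (lookup c i) (lookup c j))

T-isColPosition : (G : Graph) (c : Vec Cell (size G)) → T (isColPosition G c) ⇔ Proper G c
T-isColPosition G c = mk⇔
  (λ t i j → to (T-not-∧ _ _) (to (T-allB-allFin _) (to (T-allB-allFin _) t i) j))
  (λ proper → from (T-allB-allFin _) λ i → from (T-allB-allFin _) λ j → from (T-not-∧ _ _) (proper i j))

Consecutive : {n : ℕ} → Vec Cell n → Set
Consecutive {n} c = ∀ (i j : Fin n) → suc (toℕ i) ≡ toℕ j → T (compatible (lookup c i) (lookup c j))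

chain⇒consecutive : {n : ℕ} (c : Vec Cell n) → T (chain c) → Consecutive c
chain⇒consecutive (x ∷ [])    t fzero    fzero           ()
chain⇒consecutive (x ∷ y ∷ w) t fzero    (fsuc fzero)    _ = proj₁ (to T-∧ t)
chain⇒consecutive (x ∷ y ∷ w) t fzero    (fsuc (fsuc j)) ()
chain⇒consecutive (x ∷ y ∷ w) t (fsuc i) (fsuc j)        e =
  chain⇒consecutive (y ∷ w) (proj₂ (to T-∧ t)) i j (suc-injective e)

consecutive⇒chain : {n : ℕ} (c : Vec Cell n) → Consecutive c → T (chain c)
consecutive⇒chain []          _ = tt
consecutive⇒chain (x ∷ [])    _ = tt
consecutive⇒chain (x ∷ y ∷ w) consecutive = from T-∧
  ( consecutive fzero (fsuc fzero) refl
  , consecutive⇒chain (y ∷ w) (λ i j e → consecutive (fsuc i) (fsuc j) (cong suc e)))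

consecutive-pathAdjacent : {n : ℕ} (c : Vec Cell n) → Consecutive c → Proper (path n) c
consecutive-pathAdjacent c consecutive i j adjacent =
  [ (λ forward → consecutive i j (≡ᵇ⇒≡ _ _ forward))
  , (λ backward → T-compatible-sym (consecutive j i (≡ᵇ⇒≡ _ _ backward))) ] (to T-∨ adjacent)

path-position⇔chain : (m : ℕ) (c : Vec Cell m) → T (isColPosition (path m) c) ⇔ T (chain c)
path-position⇔chain m c = mk⇔
  (λ t → consecutive⇒chain c λ i j e → to (T-isColPosition (path m) c) t i j (from T-∨ (inj₁ (≡⇒≡ᵇ _ _ e))))
  (λ t → from (T-isColPosition (path m) c) (consecutive-pathAdjacent c (chain⇒consecutive c t)))

wrap-compatible : {n : ℕ} (c : Vec Cell (suc n)) → T (compatible (last c) (head c)) →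
  ∀ i j → T ((toℕ i ≡ᵇ 0) ∧ (suc (toℕ j) ≡ᵇ suc n)) → T (compatible (lookup c i) (lookup c j))
wrap-compatible {n} c@(_ ∷ _) closing i j ends =
  subst₂ (λ i j → T (compatible (lookup c i) (lookup c j))) (sym i≡first) (sym j≡last)
    (T-compatible-sym (subst (λ x → T (compatible x (head c))) (sym (lookup-fromℕ c)) closing))
  where
  i≡first : i ≡ fzero
  i≡first = toℕ-injective (≡ᵇ⇒≡ _ _ (proj₁ (to T-∧ ends)))
  j≡last : j ≡ fromℕ n
  j≡last = toℕ-injective (trans (≡ᵇ⇒≡ _ _ (proj₂ (to T-∧ ends))) (sym (toℕ-fromℕ n)))

cycle-position⇔closed-chain : (n : ℕ) (c : Vec Cell (suc n)) →
                              T (isColPosition (cycle (suc n)) c) ⇔ T (chain (c ∷ʳ head c))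
cycle-position⇔closed-chain n c@(_ ∷ _) = mk⇔
  (λ t → let proper = to (T-isColPosition (cycle (suc n)) c) t in from closed⇔ (open-chain proper , closing proper))
  (λ t → let linked , closes = to closed⇔ t in
         from (T-isColPosition (cycle (suc n)) c) (proper (chain⇒consecutive c linked) closes))
  where
  closed⇔ : T (chain (c ∷ʳ head c)) ⇔ (T (chain c) × T (compatible (last c) (head c)))
  closed⇔ = T-∧ ⇔-∘ T-cong (chain-∷ʳ c (head c))

  open-chain : Proper (cycle (suc n)) c → T (chain c)
  open-chain proper = consecutive⇒chain c λ i j e →
    proper i j (from (T-∨ {suc (toℕ i) ≡ᵇ toℕ j}) (inj₁ (≡⇒≡ᵇ _ _ e)))

  closing : Proper (cycle (suc n)) c → T (compatible (last c) (head c))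
  closing proper = subst (λ x → T (compatible x (head c))) (lookup-fromℕ c) (proper (fromℕ n) fzero wrap-edge)
    where
    -- Its first disjunct, suc (toℕ (fromℕ n)) ≡ᵇ 0, has already computed to false and vanished.
    wrap-edge : T (adj (cycle (suc n)) (fromℕ n) fzero)
    wrap-edge = from (T-∨ {1 ≡ᵇ toℕ (fromℕ n)}) (inj₂
      (from (T-∨ {(toℕ (fromℕ n) ≡ᵇ 0) ∧ (1 ≡ᵇ suc n)}) (inj₂ (≡⇒≡ᵇ _ _ (toℕ-fromℕ n)))))

  proper : Consecutive c → T (compatible (last c) (head c)) → Proper (cycle (suc n)) c
  proper consecutive closes i j adjacent with to (T-∨ {suc (toℕ i) ≡ᵇ toℕ j}) adjacent
  ... | inj₁ forward = consecutive i j (≡ᵇ⇒≡ _ _ forward)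
  ... | inj₂ rest with to (T-∨ {suc (toℕ j) ≡ᵇ toℕ i}) rest
  ...   | inj₁ backward = T-compatible-sym (consecutive j i (≡ᵇ⇒≡ _ _ backward))
  ...   | inj₂ wrap with to (T-∨ {(toℕ i ≡ᵇ 0) ∧ (suc (toℕ j) ≡ᵇ suc n)}) wrap
  ...     | inj₁ ends = wrap-compatible c closes i j ends
  ...     | inj₂ ends = T-compatible-sym (wrap-compatible c closes j i ends)

-- ⟨ m , s , o ⟩ is the matrix [[s + o, m, m], [m, s, o], [m, o, s]], rows and columns indexed by
-- empty, blue, red.  The identity ⟨ 0 , 1 , 0 ⟩ has this form and left multiplication by the
-- compatibility matrix ⟨ 1 , 0 , 1 ⟩ (step) preserves it, so all powers of that matrix are Shapes.
record Shape : Set where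
  constructor ⟨_,_,_⟩
  field
    mixed same opposite : ℕ

entry : Shape → Cell → Cell → ℕ
entry ⟨ m , s , o ⟩ empty empty = s + o
entry ⟨ m , s , o ⟩ empty blue  = m
entry ⟨ m , s , o ⟩ empty red   = m
entry ⟨ m , s , o ⟩ blue  empty = m
entry ⟨ m , s , o ⟩ red   empty = m
entry ⟨ m , s , o ⟩ blue  blue  = s
entry ⟨ m , s , o ⟩ red   red   = s
entry ⟨ m , s , o ⟩ blue  red   = o
entry ⟨ m , s , o ⟩ red   blue  = o

step : Shape → Shape
step ⟨ m , s , o ⟩ = ⟨ m + s + o , m + o , m + s ⟩

power : ℕ → Shape
power zero    = ⟨ 0 , 1 , 0 ⟩
power (suc n) = step (power n)

neighbourSum : Cell → (Cell → ℕ) → ℕ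
neighbourSum empty g = g empty + g blue + g red
neighbourSum blue  g = g empty + g red
neighbourSum red   g = g empty + g blue

Σᶜ-compatible : ∀ x (g : Cell → ℕ) → Σᶜ (λ y → if compatible x y then g y else 0) ≡ neighbourSum x g
Σᶜ-compatible empty g = refl
Σᶜ-compatible blue  g = cong (_+ g red) (+-identityʳ (g empty))
Σᶜ-compatible red   g = +-identityʳ (g empty + g blue)

entry-step : ∀ S x z → entry (step S) x z ≡ neighbourSum x (λ y → entry S y z)
entry-step ⟨ m , s , o ⟩ empty empty = regroup m s o
  where
  regroup : ∀ m s o → (m + o) + (m + s) ≡ (s + o) + m + m
  regroup = solve-∀
entry-step ⟨ m , s , o ⟩ empty blue  = refl
entry-step ⟨ m , s , o ⟩ empty red   = xy∙z≈xz∙y m s o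
entry-step ⟨ m , s , o ⟩ blue  empty = xy∙z≈yz∙x m s o
entry-step ⟨ m , s , o ⟩ red   empty = xy∙z≈yz∙x m s o
entry-step ⟨ m , s , o ⟩ blue  blue  = refl
entry-step ⟨ m , s , o ⟩ red   red   = refl
entry-step ⟨ m , s , o ⟩ blue  red   = refl
entry-step ⟨ m , s , o ⟩ red   blue  = refl

trace : Shape → ℕ
trace S = Σᶜ (λ x → entry S x x)

emptyColumnSum : Shape → ℕ
emptyColumnSum S = Σᶜ (λ x → entry S x empty)

trace-step² : ∀ S → trace (step (step S)) ≡ trace S + 4 * emptyColumnSum S
trace-step² ⟨ m , s , o ⟩ = expand m s o
  where
  expand : ∀ m s o → let m′ = m + s + o ; s′ = m + o ; o′ = m + s ; s″ = m′ + o′ ; o″ = m′ + s′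
                     in (s″ + o″) + s″ + s″ ≡ ((s + o) + s + s) + 4 * ((s + o) + m + m)
  expand = solve-∀

emptyColumnSum-step² : ∀ S → emptyColumnSum (step (step S)) ≡ 2 * emptyColumnSum (step S) + emptyColumnSum S
emptyColumnSum-step² ⟨ m , s , o ⟩ = expand m s o
  where
  expand : ∀ m s o → let m′ = m + s + o ; s′ = m + o ; o′ = m + s ; m″ = m′ + s′ + o′ ; s″ = m′ + o′ ; o″ = m′ + s′
                     in (s″ + o″) + m″ + m″ ≡ 2 * ((s′ + o′) + m′ + m′) + ((s + o) + m + m)
  expand = solve-∀

count-walks : ∀ n x z → count n (λ w → chain ((x ∷ w) ∷ʳ z)) ≡ entry (power (suc n)) x z
count-walks zero    empty empty = refl
count-walks zero    empty blue  = refl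
count-walks zero    empty red   = refl
count-walks zero    blue  empty = refl
count-walks zero    blue  blue  = refl
count-walks zero    blue  red   = refl
count-walks zero    red   empty = refl
count-walks zero    red   blue  = refl
count-walks zero    red   red   = refl
count-walks (suc n) x     z     = begin
  count (suc n) (λ w → chain ((x ∷ w) ∷ʳ z))
    ≡⟨ count-suc n (λ w → chain ((x ∷ w) ∷ʳ z)) ⟩
  Σᶜ (λ y → count n (λ w → compatible x y ∧ chain ((y ∷ w) ∷ʳ z)))
    ≡⟨ Σᶜ-cong (λ y → count-guard n (compatible x y) (λ w → chain ((y ∷ w) ∷ʳ z))) ⟩
  Σᶜ (λ y → if compatible x y then count n (λ w → chain ((y ∷ w) ∷ʳ z)) else 0)
    ≡⟨ Σᶜ-cong (λ y → cong (λ k → if compatible x y then k else 0) (count-walks n y z)) ⟩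
  Σᶜ (λ y → if compatible x y then entry (power (suc n)) y z else 0)
    ≡⟨ Σᶜ-compatible x (λ y → entry (power (suc n)) y z) ⟩
  neighbourSum x (λ y → entry (power (suc n)) y z)
    ≡⟨ sym (entry-step (power (suc n)) x z) ⟩
  entry (power (suc (suc n))) x z ∎

path-count : ∀ m → numColPositions (path (suc m)) ≡ emptyColumnSum (power (suc m))
path-count m = begin
  numColPositions (path (suc m))
    ≡⟨ count-cong (suc m) (path-position⇔chain (suc m)) ⟩
  count (suc m) chain
    ≡⟨ count-suc m chain ⟩
  Σᶜ (λ x → count m (λ w → chain (x ∷ w)))
    ≡⟨ Σᶜ-cong (λ x → count-cong m (λ w → T-cong (sym (chain-∷ʳ-empty (x ∷ w))))) ⟩
  Σᶜ (λ x → count m (λ w → chain ((x ∷ w) ∷ʳ empty)))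
    ≡⟨ Σᶜ-cong (λ x → count-walks m x empty) ⟩
  emptyColumnSum (power (suc m)) ∎

cycle-count : ∀ n → numColPositions (cycle (suc n)) ≡ trace (power (suc n))
cycle-count n = begin
  numColPositions (cycle (suc n))
    ≡⟨ count-cong (suc n) (cycle-position⇔closed-chain n) ⟩
  count (suc n) (λ c → chain (c ∷ʳ head c))
    ≡⟨ count-suc n (λ c → chain (c ∷ʳ head c)) ⟩
  Σᶜ (λ x → count n (λ w → chain ((x ∷ w) ∷ʳ x)))
    ≡⟨ Σᶜ-cong (λ x → count-walks n x x) ⟩
  trace (power (suc n)) ∎

path-recurrence : ∀ j → numColPositions (path (3 + j))
                        ≡ 2 * numColPositions (path (2 + j)) + numColPositions (path (1 + j))
path-recurrence j = begin
  numColPositions (path (3 + j))                               ≡⟨ path-count (2 + j) ⟩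
  emptyColumnSum (power (3 + j))                               ≡⟨ emptyColumnSum-step² (power (1 + j)) ⟩
  2 * emptyColumnSum (power (2 + j)) + emptyColumnSum (power (1 + j))
    ≡⟨ sym (cong₂ (λ p q → 2 * p + q) (path-count (1 + j)) (path-count j)) ⟩
  2 * numColPositions (path (2 + j)) + numColPositions (path (1 + j)) ∎

cycle-recurrence : ∀ j → numColPositions (cycle (3 + j))
                         ≡ numColPositions (cycle (1 + j)) + 4 * numColPositions (path (1 + j))
cycle-recurrence j = begin
  numColPositions (cycle (3 + j))                              ≡⟨ cycle-count (2 + j) ⟩
  trace (power (3 + j))                                        ≡⟨ trace-step² (power (1 + j)) ⟩
  trace (power (1 + j)) + 4 * emptyColumnSum (power (1 + j))
    ≡⟨ sym (cong₂ (λ c p → c + 4 * p) (cycle-count j) (path-count j)) ⟩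
  numColPositions (cycle (1 + j)) + 4 * numColPositions (path (1 + j)) ∎

combine-recurrences : ∀ {c c′ p₁ p₂ p₃ p₄} → c′ ≡ c + 4 * p₃ → p₄ ≡ 2 * p₃ + p₂ → p₃ ≡ 2 * p₂ + p₁ →
                      c′ ≡ p₄ + 3 * p₂ + 2 * p₁ + c
combine-recurrences {c} {p₁ = p₁} {p₂} refl refl refl = arithmetic c p₁ p₂
  where
  arithmetic : ∀ c p₁ p₂ → c + 4 * (2 * p₂ + p₁) ≡ (2 * (2 * p₂ + p₁) + p₂) + 3 * p₂ + 2 * p₁ + c
  arithmetic = solve-∀

mainTheorem8 : (n : ℕ) → 5 ≤ n →
    numColPositions (cycle n)
      ≡ numColPositions (path (n ∸ 1)) + 3 * numColPositions (path (n ∸ 3))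
        + 2 * numColPositions (path (n ∸ 4)) + numColPositions (cycle (n ∸ 2))
mainTheorem8 (suc (suc (suc (suc (suc k))))) (s≤s (s≤s (s≤s (s≤s (s≤s z≤n))))) =
  combine-recurrences (cycle-recurrence (2 + k)) (path-recurrence (1 + k)) (path-recurrence k)
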